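{- Let $d\ge3$ and let $Z=Z(V_R\cup V_B)$ be a $d$-dimensional symmetric $\Pi$-zonotope with $V_R\cup V_B\subseteq V(d)$ whose graph $G_Z$ (on $d+1$ vertices) is connected. Then the belt distance between the red facet and the blue facet of $Z$ equals $2$ if and only if there is a vertex $A$ which is a leaf (vertex of degree $1$) in both the red subgraph $G_R$ and the blue subgraph $G_B$.
   Context: Let $\mathbf e_1,\dots,\mathbf e_{d+1}$ be the standard basis of $\mathbb R^{d+1}$, $\mathbf e_{ij}=\mathbf e_i-\mathbf e_j$, $V(d)=\{\mathbf e_{ij}:i<j\}$, $Z(V)=\sum_{\mathbf v\in V}[\mathbf 0,\mathbf v]$. The graph of $Z(V)$ has vertices $1,\dots,d+1$ and an edge $\{i,j\}$ iff $\pm\mathbf e_{ij}\in V$; edges from $V_R$ are red, from $V_B$ blue; $G_R$ ($G_B$) is the spanning subgraph on all $d+1$ vertices formed by red (blue) edges. Two sets $V_1,V_2$ in a $d$-dimensional space, each of $d-1$ vectors spanning a $(d-1)$-dimensional subspace, are conjugate if for all $\mathbf u_1\in V_1,\mathbf u_2\in V_2$ both $\{\mathbf u_1\}\cup V_2$ and $\{\mathbf u_2\}\cup V_1$ span $d$-dimensional spaces; $Z(V_R\cup V_B)$ is symmetric if $V_R,V_B$ are conjugate in the span of $V_R\cup V_B$. The red (blue) facets are the facets of $Z$ parallel to the span of $V_R$ ($V_B$). A belt is the set of facets parallel to a given face of codimension 2; the Venkov graph has vertices the pairs of opposite facets, adjacent iff some belt contains both pairs; belt distance between facets is distance in this graph.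 -}

module Defs where

open import Data.Nat using (ℕ; zero; suc; _<_; _∸_)
open import Data.Integer as ℤ using (ℤ; 0ℤ; 1ℤ)
open import Data.Fin using (Fin) renaming (_<_ to _<ᶠ_)
open import Data.Fin.Properties using (_≟_)
open import Data.List using (List; []; _∷_; length; lookup; _++_; filter)
open import Data.List.Membership.Propositional using (_∈_)
open import Data.List.Relation.Unary.All using (All)
open import Data.List.Relation.Unary.Unique.Propositional using (Unique)
open import Data.List.Relation.Binary.Sublist.Propositional using (_⊆_)
open import Data.Product using (Σ; ∃; _×_; _,_; proj₁; proj₂)
open import Data.Sum using (_⊎_)
open import Relation.Nullary using (¬_; yes; no)
open import Relation.Binary.PropositionalEquality using (_≡_)

Vect : ℕ → Set
Vect n = Fin n → ℤ

zeroV : ∀ {n} → Vect n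
zeroV _ = 0ℤ

_+V_ : ∀ {n} → Vect n → Vect n → Vect n
(u +V v) k = u k ℤ.+ v k

_·V_ : ∀ {n} → ℤ → Vect n → Vect n
(c ·V v) k = c ℤ.* v k

_≈V_ : ∀ {n} → Vect n → Vect n → Set
u ≈V v = ∀ k → u k ≡ v k

e : ∀ {n} → Fin n → Vect n
e i k with i ≟ k
... | yes _ = 1ℤ
... | no  _ = 0ℤ

-- An edge {i,j} with i < j, encoding the vector e_ij = e_i - e_j ∈ V(d)
Edge : ℕ → Set
Edge n = Fin n × Fin n

IsVdEdge : ∀ {n} → Edge n → Set
IsVdEdge (i , j) = i <ᶠ j

vec : ∀ {n} → Edge n → Vect n
vec (i , j) k = e i k ℤ.- e j k

lincomb : ∀ {n} (L : List (Edge n)) → (Fin (length L) → ℤ) → Vect n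
lincomb [] c = zeroV
lincomb (x ∷ L) c = (c Fin.zero ·V vec x) +V lincomb L (λ t → c (Fin.suc t))
  where import Data.Fin as Fin

-- v lies in the (rational) linear span of the vectors of L
InSpan : ∀ {n} → List (Edge n) → Vect n → Set
InSpan L v = Σ ℤ λ k → (¬ k ≡ 0ℤ) × Σ (Fin (length L) → ℤ) λ c → lincomb L c ≈V (k ·V v)

Independent : ∀ {n} → List (Edge n) → Set
Independent L = ∀ (c : Fin (length L) → ℤ) → lincomb L c ≈V zeroV → ∀ t → c t ≡ 0ℤ

HasRank : ∀ {n} → List (Edge n) → ℕ → Set
HasRank L r = Σ (List _) λ S → (S ⊆ L) × (length S ≡ r) × Independent S
                                × All (λ x → InSpan S (vec x)) L

SpanSub : ∀ {n} → List (Edge n) → List (Edge n) → Set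
SpanSub L M = All (λ x → InSpan M (vec x)) L

SameSpan : ∀ {n} → List (Edge n) → List (Edge n) → Set
SameSpan L M = SpanSub L M × SpanSub M L

Conjugate : ∀ {n} → ℕ → List (Edge n) → List (Edge n) → Set
Conjugate D V₁ V₂ =
  (length V₁ ≡ D ∸ 1) × HasRank V₁ (D ∸ 1) ×
  (length V₂ ≡ D ∸ 1) × HasRank V₂ (D ∸ 1) ×
  (∀ u → u ∈ V₁ → HasRank (u ∷ V₂) D) ×
  (∀ u → u ∈ V₂ → HasRank (u ∷ V₁) D)

-- A pair of opposite facets of Z(V) is determined by (and determines) the
-- hyperplane of span V it is parallel to; these hyperplanes are exactly the
-- (d-1)-dimensional subspaces spanned by generators.  We represent such a pair
-- by a list H of generators spanning it; two lists denote the same pair iff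
-- they have the same span.

IsFacetPair : ∀ {n} → ℕ → List (Edge n) → List (Edge n) → Set
IsFacetPair d V H = All (_∈ V) H × HasRank H (d ∸ 1)

-- Codimension-2 faces are parallel to the (d-2)-dimensional subspaces spanned by
-- generators; the belt of such a face consists of the facets whose hyperplane
-- contains that subspace.  Two facet pairs are adjacent in the Venkov graph iff
-- some belt contains both.
VenkovAdj : ∀ {n} → ℕ → List (Edge n) → List (Edge n) → List (Edge n) → Set
VenkovAdj d V H₁ H₂ = Σ (List _) λ L → All (_∈ V) L × HasRank L (d ∸ 2)
                         × SpanSub L H₁ × SpanSub L H₂

data VenkovWalk {n} (d : ℕ) (V : List (Edge n)) :
                List (Edge n) → List (Edge n) → ℕ → Set where
  here : ∀ {H H'} → SameSpan H H' → VenkovWalk d V H H' 0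
  step : ∀ {H H' H'' m} → IsFacetPair d V H' → VenkovAdj d V H H' →
         VenkovWalk d V H' H'' m → VenkovWalk d V H H'' (suc m)

BeltDistance : ∀ {n} → ℕ → List (Edge n) → List (Edge n) → List (Edge n) → ℕ → Set
BeltDistance d V H₁ H₂ m =
  VenkovWalk d V H₁ H₂ m × (∀ m' → m' < m → ¬ VenkovWalk d V H₁ H₂ m')

Incident : ∀ {n} → Fin n → Edge n → Set
Incident a (i , j) = (a ≡ i) ⊎ (a ≡ j)

degree : ∀ {n} → List (Edge n) → Fin n → ℕ
degree E a = length (filter (λ x → incident? x) E)
  where
  open import Relation.Nullary.Decidable using (_⊎-dec_)
  incident? : ∀ x → _
  incident? (i , j) = (a ≟ i) ⊎-dec (a ≟ j)

data Reach {n} (E : List (Edge n)) : Fin n → Fin n → Set where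
  refl' : ∀ {a} → Reach E a a
  fwd : ∀ {a b c} → (a , b) ∈ E → Reach E b c → Reach E a c
  bwd : ∀ {a b c} → (b , a) ∈ E → Reach E b c → Reach E a c

Connected : ∀ {n} → List (Edge n) → Set
Connected E = ∀ a b → Reach E a b

{-# OPTIONS --safe #-}

-- For generators e_i − e_j, the vector e_a − e_b lies in the span of a set L exactly when a and b are
-- connected in the graph L, so L has rank n − (number of components of L). Conjugacy then says that the
-- red and the blue graph have two components each and that every edge of one colour joins the two
-- components of the other; in particular no edge has its ends connected in both colours.
-- A walk red facet – H – blue facet passes through belts L₁ ⊆ red ∩ H and L₂ ⊆ H ∩ blue with three
-- components each. If an edge of L₁ and an edge of L₂ lie in a common class of H, the other class of H is
-- a class of both L₁ and L₂; it contains no edge of L₁ or L₂, and counting edges shows that any of its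
-- vertices is a leaf of both colours. Otherwise the two classes of H are the ends of these two edges, so
-- there are only four vertices and a common leaf is found directly. Conversely, if A is a leaf of both
-- colours, the edges away from A span a facet sharing a belt with each coloured facet, while distance 0
-- or 1 would put some edge inside a red and a blue component at once.

module Submission where

open import Defs
open import Level using (0ℓ)
open import Data.Nat as ℕ using (ℕ; zero; suc; _≤_; _<_; z≤n; s≤s)
import Data.Nat.Properties as ℕP
open import Data.Fin as F using (Fin; punchIn; punchOut)
import Data.Fin.Properties as FP
open import Data.Vec.Functional using () renaming (_∷_ to _◂_)
open import Data.List using (List; []; _∷_; length; _++_; allFin)
open import Data.List.Membership.Propositional using (_∈_)
open import Data.List.Relation.Unary.All using (All)
open import Data.List.Relation.Unary.Unique.Propositional using (Unique)
open import Data.List.Membership.Propositional.Properties using (∈-allFin)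
open import Data.List.Relation.Unary.Any using (here; there)
open import Data.Product using (Σ; ∃; _×_; _,_; proj₁; proj₂)
open import Data.Sum using (_⊎_; inj₁; inj₂)
open import Data.Empty using (⊥-elim)
open import Function using (id; _∘_)
open import Function.Bundles using (_⇔_; mk⇔)
open import Relation.Nullary using (¬_; Dec; yes; no; contradiction)
open import Relation.Nullary.Decidable using (_⊎-dec_; _×-dec_)
open import Relation.Binary using (Rel; IsDecEquivalence)
open import Relation.Binary.PropositionalEquality using (_≡_; _≢_; refl; sym; trans; cong; cong₂; subst; module ≡-Reasoning)

-- Counting the classes of a decidable equivalence on Fin n

module ClassCount {n : ℕ} {_∼_ : Rel (Fin n) 0ℓ} (isDecEquivalence : IsDecEquivalence _∼_) where
  open IsDecEquivalence isDecEquivalence using (_≟_) renaming (refl to ∼-refl; sym to ∼-sym; trans to ∼-trans)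

  Separated : ∀ {m} → (Fin m → Fin n) → Set
  Separated g = ∀ i j → g i ∼ g j → i ≡ j

  Covering : ∀ {m} → (Fin m → Fin n) → Set
  Covering h = ∀ v → ∃ λ k → v ∼ h k

  separated≤covering : ∀ {m m′} {g : Fin m → Fin n} {h : Fin m′ → Fin n} →
                       Separated g → Covering h → m ≤ m′
  separated≤covering {m} {m′} {g} {h} sep cov with m ℕ.≤? m′
  ... | yes m≤m′ = m≤m′
  ... | no m≰m′ with FP.pigeonhole (ℕP.≰⇒> m≰m′) (λ i → proj₁ (cov (g i)))
  ... | i , j , i<j , same =
    contradiction (sep i j (∼-trans (proj₂ (cov (g i)))
                              (subst (λ k → h k ∼ g j) (sym same) (∼-sym (proj₂ (cov (g j)))))))
                  (FP.<⇒≢ i<j)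

  separated-◂ : ∀ {m v} {g : Fin m → Fin n} →
                ¬ (∃ λ k → v ∼ g k) → Separated g → Separated (v ◂ g)
  separated-◂ new sep F.zero    F.zero    _ = refl
  separated-◂ new sep F.zero    (F.suc j) r = ⊥-elim (new (j , r))
  separated-◂ new sep (F.suc i) F.zero    r = ⊥-elim (new (i , ∼-sym r))
  separated-◂ new sep (F.suc i) (F.suc j) r = cong F.suc (sep i j r)

  record SeparatedFamily : Set where
    field
      size      : ℕ
      family    : Fin size → Fin n
      separated : Separated family

  separatedCovering : (vs : List (Fin n)) →
    Σ SeparatedFamily λ s → ∀ v → v ∈ vs → ∃ λ k → v ∼ SeparatedFamily.family s k
  separatedCovering [] = record { size = 0 ; family = λ () ; separated = λ () } , λ _ ()
  separatedCovering (v ∷ vs) with separatedCovering vs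
  ... | s , cov with FP.any? (λ k → v ≟ SeparatedFamily.family s k)
  ... | yes old = s , λ { w (here refl) → old ; w (there w∈) → cov w w∈ }
  ... | no new =
    record { size = suc size ; family = v ◂ family ; separated = separated-◂ new separated } , cov′
    where
    open SeparatedFamily s
    cov′ : ∀ w → w ∈ v ∷ vs → ∃ λ k → w ∼ (v ◂ family) k
    cov′ w (here refl) = F.zero , ∼-refl
    cov′ w (there w∈) = let k , r = cov w w∈ in F.suc k , r

  -- Abstract, so that the greedy construction is never unfolded when comparing class counts.
  abstract
    representatives : SeparatedFamily
    representatives = proj₁ (separatedCovering (allFin n))

    classes : ℕ
    classes = SeparatedFamily.size representatives

    representative : Fin classes → Fin n
    representative = SeparatedFamily.family representatives

    representative-separated : Separated representative
    representative-separated = SeparatedFamily.separated representatives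

    representative-covering : Covering representative
    representative-covering v = proj₂ (separatedCovering (allFin n)) v (∈-allFin v)

  separated⇒≤classes : ∀ {m} {g : Fin m → Fin n} → Separated g → m ≤ classes
  separated⇒≤classes sep = separated≤covering sep representative-covering

  covering⇒classes≤ : ∀ {m} {h : Fin m → Fin n} → Covering h → classes ≤ m
  covering⇒classes≤ cov = separated≤covering representative-separated cov

  separated∧size≡classes⇒covering : ∀ {m} {g : Fin m → Fin n} → Separated g → m ≡ classes → Covering g
  separated∧size≡classes⇒covering {m} {g} sep m≡c v with FP.any? (λ k → v ≟ g k)
  ... | yes old = old
  ... | no new = contradiction (subst (suc m ≤_) (sym m≡c) (separated⇒≤classes (separated-◂ new sep)))
                               (ℕP.n≮n m)

module _ {n : ℕ} {_∼₁_ _∼₂_ : Rel (Fin n) 0ℓ}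
         (eq₁ : IsDecEquivalence _∼₁_) (eq₂ : IsDecEquivalence _∼₂_) where
  open ClassCount

  classes-antitone : (∀ {a b} → a ∼₁ b → a ∼₂ b) → classes eq₂ ≤ classes eq₁
  classes-antitone ∼₁⇒∼₂ =
    separated≤covering eq₁ (λ i j r → representative-separated eq₂ i j (∼₁⇒∼₂ r)) (representative-covering eq₁)

-- Connected components of a graph given by its list of edges

-- A path from a to b in L uses the first edge of L at most once, in one of its two directions.
Conn : ∀ {n} → List (Edge n) → Fin n → Fin n → Set
Conn []            a b = a ≡ b
Conn ((i , j) ∷ L) a b = Conn L a b ⊎ (Conn L a i × Conn L j b) ⊎ (Conn L a j × Conn L i b)

conn? : ∀ {n} (L : List (Edge n)) a b → Dec (Conn L a b)
conn? []            a b = a FP.≟ b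
conn? ((i , j) ∷ L) a b =
  conn? L a b ⊎-dec ((conn? L a i ×-dec conn? L j b) ⊎-dec (conn? L a j ×-dec conn? L i b))

Conn-refl : ∀ {n} (L : List (Edge n)) {a} → Conn L a a
Conn-refl []       = refl
Conn-refl (_ ∷ L) = inj₁ (Conn-refl L)

Conn-sym : ∀ {n} (L : List (Edge n)) {a b} → Conn L a b → Conn L b a
Conn-sym []            a≡b                   = sym a≡b
Conn-sym ((i , j) ∷ L) (inj₁ p)              = inj₁ (Conn-sym L p)
Conn-sym ((i , j) ∷ L) (inj₂ (inj₁ (p , q))) = inj₂ (inj₂ (Conn-sym L q , Conn-sym L p))
Conn-sym ((i , j) ∷ L) (inj₂ (inj₂ (p , q))) = inj₂ (inj₁ (Conn-sym L q , Conn-sym L p))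

Conn-trans : ∀ {n} (L : List (Edge n)) {a b c} → Conn L a b → Conn L b c → Conn L a c
Conn-trans []            p q = trans p q
Conn-trans ((i , j) ∷ L) (inj₁ p)              (inj₁ q)              = inj₁ (Conn-trans L p q)
Conn-trans ((i , j) ∷ L) (inj₁ p)              (inj₂ (inj₁ (q , r))) = inj₂ (inj₁ (Conn-trans L p q , r))
Conn-trans ((i , j) ∷ L) (inj₁ p)              (inj₂ (inj₂ (q , r))) = inj₂ (inj₂ (Conn-trans L p q , r))
Conn-trans ((i , j) ∷ L) (inj₂ (inj₁ (p , q))) (inj₁ r)              = inj₂ (inj₁ (p , Conn-trans L q r))
Conn-trans ((i , j) ∷ L) (inj₂ (inj₁ (p , _))) (inj₂ (inj₁ (_ , s))) = inj₂ (inj₁ (p , s))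
Conn-trans ((i , j) ∷ L) (inj₂ (inj₁ (p , _))) (inj₂ (inj₂ (_ , s))) = inj₁ (Conn-trans L p s)
Conn-trans ((i , j) ∷ L) (inj₂ (inj₂ (p , q))) (inj₁ r)              = inj₂ (inj₂ (p , Conn-trans L q r))
Conn-trans ((i , j) ∷ L) (inj₂ (inj₂ (p , _))) (inj₂ (inj₁ (_ , s))) = inj₁ (Conn-trans L p s)
Conn-trans ((i , j) ∷ L) (inj₂ (inj₂ (p , _))) (inj₂ (inj₂ (_ , s))) = inj₂ (inj₂ (p , s))

¬Conn⇒≢ : ∀ {n} (L : List (Edge n)) {a b} → ¬ Conn L a b → a ≢ b
¬Conn⇒≢ L ¬ab refl = ¬ab (Conn-refl L)

Conn-isDecEquivalence : ∀ {n} (L : List (Edge n)) → IsDecEquivalence (Conn L)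
Conn-isDecEquivalence L = record
  { isEquivalence = record { refl = Conn-refl L ; sym = Conn-sym L ; trans = Conn-trans L }
  ; _≟_ = conn? L
  }

components : ∀ {n} → List (Edge n) → ℕ
components L = ClassCount.classes (Conn-isDecEquivalence L)

_⊆ᶜ_ : ∀ {n} → List (Edge n) → List (Edge n) → Set
L ⊆ᶜ M = ∀ {a b} → Conn L a b → Conn M a b

Conn-∷ : ∀ {n} x (L : List (Edge n)) → L ⊆ᶜ (x ∷ L)
Conn-∷ (i , j) L = inj₁

Conn-edge : ∀ {n} (L : List (Edge n)) {i j} → (i , j) ∈ L → Conn L i j
Conn-edge ((i , j) ∷ L) (here refl) = inj₂ (inj₁ (Conn-refl L , Conn-refl L))
Conn-edge (x ∷ L)       (there e∈)  = Conn-∷ x L (Conn-edge L e∈)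

Conn-least : ∀ {n} (L M : List (Edge n)) → (∀ {i j} → (i , j) ∈ L → Conn M i j) → L ⊆ᶜ M
Conn-least []            M edges refl = Conn-refl M
Conn-least ((i , j) ∷ L) M edges (inj₁ p) = Conn-least L M (edges ∘ there) p
Conn-least ((i , j) ∷ L) M edges (inj₂ (inj₁ (p , q))) =
  Conn-trans M (Conn-least L M (edges ∘ there) p)
    (Conn-trans M (edges (here refl)) (Conn-least L M (edges ∘ there) q))
Conn-least ((i , j) ∷ L) M edges (inj₂ (inj₂ (p , q))) =
  Conn-trans M (Conn-least L M (edges ∘ there) p)
    (Conn-trans M (Conn-sym M (edges (here refl))) (Conn-least L M (edges ∘ there) q))

Conn-⊆ : ∀ {n} {L M : List (Edge n)} → (∀ {x} → x ∈ L → x ∈ M) → L ⊆ᶜ M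
Conn-⊆ {L = L} {M} L⊆M = Conn-least L M (Conn-edge M ∘ L⊆M)

module _ {n : ℕ} where
  open ClassCount
  open import Data.Nat using (_+_)

  components-antitone : {L M : List (Edge n)} → L ⊆ᶜ M → components M ≤ components L
  components-antitone {L} {M} = classes-antitone (Conn-isDecEquivalence L) (Conn-isDecEquivalence M)

  components-cong : {L M : List (Edge n)} → L ⊆ᶜ M → M ⊆ᶜ L → components L ≡ components M
  components-cong L⊆M M⊆L = ℕP.≤-antisym (components-antitone M⊆L) (components-antitone L⊆M)

  components-[] : components {n} [] ≡ n
  components-[] = ℕP.≤-antisym (covering⇒classes≤ iseq {h = id} (λ v → v , refl))
                               (separated⇒≤classes iseq {g = id} (λ i j → id))
    where iseq = Conn-isDecEquivalence {n} []

  private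
    module CC (L : List (Edge n)) = ClassCount (Conn-isDecEquivalence L)

  -- Dropping the class of j from a system of representatives for L leaves one separated for (i , j) ∷ L.
  separated-bound-∷ : ∀ x (L : List (Edge n)) {m} {g : Fin m → Fin n} →
                      CC.Separated L g → CC.Covering L g → m ≤ suc (components (x ∷ L))
  separated-bound-∷ x       L {zero}  sep cov = z≤n
  separated-bound-∷ (i , j) L {suc m} {g} sep cov =
    let r , jr = cov j in s≤s (CC.separated⇒≤classes ((i , j) ∷ L) (separated-punchIn r jr))
    where
    separated-punchIn : ∀ r → Conn L j (g r) → CC.Separated ((i , j) ∷ L) (g ∘ punchIn r)
    separated-punchIn r jr a b (inj₁ p) = FP.punchIn-injective r a b (sep _ _ p)
    separated-punchIn r jr a b (inj₂ (inj₁ (_ , q))) =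
      ⊥-elim (FP.punchInᵢ≢i r b (sep _ _ (Conn-trans L (Conn-sym L q) jr)))
    separated-punchIn r jr a b (inj₂ (inj₂ (p , _))) =
      ⊥-elim (FP.punchInᵢ≢i r a (sep _ _ (Conn-trans L p jr)))

  -- When (i , j) joins two classes of L, the class of j is absorbed into that of i.
  covering-bound-∷ : ∀ {i j} (L : List (Edge n)) → ¬ Conn L i j → ∀ {m} {g : Fin m → Fin n} →
                     CC.Covering L g → suc (components ((i , j) ∷ L)) ≤ m
  covering-bound-∷ {i} {j} L ¬ij {zero} cov with () ← proj₁ (cov j)
  covering-bound-∷ {i} {j} L ¬ij {suc m} {g} cov =
    let r , jr = cov j in s≤s (CC.covering⇒classes≤ ((i , j) ∷ L) (covering-punchIn r jr))
    where
    covering-punchIn : ∀ r → Conn L j (g r) → CC.Covering ((i , j) ∷ L) (g ∘ punchIn r)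
    covering-punchIn r jr v with cov v
    ... | k , vk with k FP.≟ r
    ... | no k≢r = punchOut (k≢r ∘ sym) ,
                   inj₁ (subst (Conn L v ∘ g) (sym (FP.punchIn-punchOut (k≢r ∘ sym))) vk)
    ... | yes refl with cov i
    ... | k′ , ik′ with k′ FP.≟ r
    ... | yes refl = ⊥-elim (¬ij (Conn-trans L ik′ (Conn-sym L jr)))
    ... | no k′≢r = punchOut (k′≢r ∘ sym) ,
                   inj₂ (inj₂ (Conn-trans L vk (Conn-sym L jr) ,
                     subst (Conn L i ∘ g) (sym (FP.punchIn-punchOut (k′≢r ∘ sym))) ik′))

  components-∷-≤ : ∀ x (L : List (Edge n)) → components L ≤ suc (components (x ∷ L))
  components-∷-≤ x L = separated-bound-∷ x L (CC.representative-separated L) (CC.representative-covering L)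

  components-∷-bridge : ∀ {i j} (L : List (Edge n)) → ¬ Conn L i j →
                        suc (components ((i , j) ∷ L)) ≡ components L
  components-∷-bridge L ¬ij =
    ℕP.≤-antisym (covering-bound-∷ L ¬ij (CC.representative-covering L)) (components-∷-≤ _ L)

  components-∷-cycle : ∀ {i j} (L : List (Edge n)) → Conn L i j → components ((i , j) ∷ L) ≡ components L
  components-∷-cycle {i} {j} L ij = components-cong
    (Conn-least ((i , j) ∷ L) L λ { (here refl) → ij ; (there e∈) → Conn-edge L e∈ })
    (Conn-∷ (i , j) L)

  n≤components+length : (L : List (Edge n)) → n ≤ components L + length L
  n≤components+length [] = ℕP.≤-reflexive (trans (sym components-[]) (sym (ℕP.+-identityʳ _)))
  n≤components+length (x ∷ L) = begin
    n                                    ≤⟨ n≤components+length L ⟩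
    components L + length L              ≤⟨ ℕP.+-monoˡ-≤ (length L) (components-∷-≤ x L) ⟩
    suc (components (x ∷ L)) + length L  ≡⟨ sym (ℕP.+-suc (components (x ∷ L)) (length L)) ⟩
    components (x ∷ L) + length (x ∷ L)  ∎
    where open ℕP.≤-Reasoning

-- Spans of generators e_i − e_j and connectivity

module _ {n : ℕ} where
  open import Data.Integer using (ℤ; 0ℤ; 1ℤ; _+_; _*_; -_; _-_)
  import Data.Integer.Properties as ℤP
  open import Data.Integer.Tactic.RingSolver using (solve-∀)
  open import Algebra.Properties.Semiring.Sum ℤP.+-*-semiring
    using (sum; sum-cong-≗; ∑-distrib-+; *-distribˡ-sum; sum-replicate-zero)
  open import Data.Vec.Functional using (tail)
  open import Data.List.Relation.Unary.All using ([]; _∷_)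

  lincomb-+ : (L : List (Edge n)) (c₁ c₂ : Fin (length L) → ℤ) →
              lincomb L (λ t → c₁ t + c₂ t) ≈V (lincomb L c₁ +V lincomb L c₂)
  lincomb-+ []      c₁ c₂ k = refl
  lincomb-+ (x ∷ L) c₁ c₂ k =
    trans (cong ((c₁ F.zero + c₂ F.zero) * vec x k +_) (lincomb-+ L (tail c₁) (tail c₂) k))
          (interchange (c₁ F.zero) (c₂ F.zero) (vec x k) _ _)
    where
    interchange : ∀ a b v x y → (a + b) * v + (x + y) ≡ (a * v + x) + (b * v + y)
    interchange = solve-∀

  lincomb-neg : (L : List (Edge n)) (c : Fin (length L) → ℤ) → ∀ k → lincomb L (λ t → - c t) k ≡ - lincomb L c k
  lincomb-neg []      c k = refl
  lincomb-neg (x ∷ L) c k =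
    trans (cong ((- c F.zero) * vec x k +_) (lincomb-neg L (tail c) k)) (neg-distrib (c F.zero) (vec x k) _)
    where
    neg-distrib : ∀ a v x → (- a) * v + (- x) ≡ - (a * v + x)
    neg-distrib = solve-∀

  private
    0*+ : ∀ v y → 0ℤ * v + y ≡ y
    0*+ = solve-∀

  -- A path from a to b in L telescopes to e_a − e_b.
  Conn⇒lincomb : (L : List (Edge n)) {a b : Fin n} → Conn L a b →
                 Σ (Fin (length L) → ℤ) λ c → lincomb L c ≈V vec (a , b)
  Conn⇒lincomb [] {a} refl = (λ ()) , λ k → sym (ℤP.+-inverseʳ (e a k))
  Conn⇒lincomb ((i , j) ∷ L) (inj₁ p) =
    let c , c≈ = Conn⇒lincomb L p in
    (0ℤ ◂ c) , λ k → trans (0*+ (vec (i , j) k) (lincomb L c k)) (c≈ k)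
  Conn⇒lincomb ((i , j) ∷ L) {a} {b} (inj₂ (inj₁ (p , q))) =
    let c₁ , c₁≈ = Conn⇒lincomb L p ; c₂ , c₂≈ = Conn⇒lincomb L q in
    (1ℤ ◂ λ t → c₁ t + c₂ t) , λ k →
      trans (cong (1ℤ * vec (i , j) k +_) (trans (lincomb-+ L c₁ c₂ k) (cong₂ _+_ (c₁≈ k) (c₂≈ k))))
            (telescope (e a k) (e b k) (e i k) (e j k))
    where
    telescope : ∀ a b i j → 1ℤ * (i - j) + ((a - i) + (j - b)) ≡ a - b
    telescope = solve-∀
  Conn⇒lincomb ((i , j) ∷ L) {a} {b} (inj₂ (inj₂ (p , q))) =
    let c₁ , c₁≈ = Conn⇒lincomb L p ; c₂ , c₂≈ = Conn⇒lincomb L q in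
    (- 1ℤ ◂ λ t → c₁ t + c₂ t) , λ k →
      trans (cong (- 1ℤ * vec (i , j) k +_) (trans (lincomb-+ L c₁ c₂ k) (cong₂ _+_ (c₁≈ k) (c₂≈ k))))
            (telescope (e a k) (e b k) (e i k) (e j k))
    where
    telescope : ∀ a b i j → - 1ℤ * (i - j) + ((a - j) + (i - b)) ≡ a - b
    telescope = solve-∀

  Conn⇒InSpan : (L : List (Edge n)) {a b : Fin n} → Conn L a b → InSpan L (vec (a , b))
  Conn⇒InSpan L p = let c , c≈ = Conn⇒lincomb L p in 1ℤ , (λ ()) , c , λ k → trans (c≈ k) (sym (ℤP.*-identityˡ _))

  ⟨_,_⟩ : ∀ {m} → (Fin m → ℤ) → Vect m → ℤ
  ⟨ w , v ⟩ = sum (λ k → w k * v k)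

  ⟨,⟩-cong : ∀ {m} (w : Fin m → ℤ) {u v : Vect m} → u ≈V v → ⟨ w , u ⟩ ≡ ⟨ w , v ⟩
  ⟨,⟩-cong w u≈v = sum-cong-≗ (λ k → cong (w k *_) (u≈v k))

  ⟨,⟩-zero : ∀ {m} (w : Fin m → ℤ) → ⟨ w , zeroV ⟩ ≡ 0ℤ
  ⟨,⟩-zero {m} w = trans (sum-cong-≗ (λ k → ℤP.*-zeroʳ (w k))) (sum-replicate-zero m)

  ⟨,⟩-+ : ∀ {m} (w : Fin m → ℤ) (u v : Vect m) → ⟨ w , u +V v ⟩ ≡ ⟨ w , u ⟩ + ⟨ w , v ⟩
  ⟨,⟩-+ w u v = trans (sum-cong-≗ (λ k → ℤP.*-distribˡ-+ (w k) (u k) (v k)))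
                      (∑-distrib-+ (λ k → w k * u k) (λ k → w k * v k))

  ⟨,⟩-· : ∀ {m} (w : Fin m → ℤ) a (v : Vect m) → ⟨ w , a ·V v ⟩ ≡ a * ⟨ w , v ⟩
  ⟨,⟩-· w a v = trans (sum-cong-≗ (λ k → swap (w k) a (v k))) (sym (*-distribˡ-sum a (λ k → w k * v k)))
    where
    swap : ∀ x a y → x * (a * y) ≡ a * (x * y)
    swap = solve-∀

  e-diag : ∀ {m} {i k : Fin m} → i ≡ k → e i k ≡ 1ℤ
  e-diag {i = i} {k} i≡k with i FP.≟ k
  ... | yes _   = refl
  ... | no  i≢k = contradiction i≡k i≢k

  e-off-diag : ∀ {m} {i k : Fin m} → i ≢ k → e i k ≡ 0ℤ
  e-off-diag {i = i} {k} i≢k with i FP.≟ k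
  ... | yes i≡k = contradiction i≡k i≢k
  ... | no  _   = refl

  e-suc : ∀ {m} (i k : Fin m) → e (F.suc i) (F.suc k) ≡ e i k
  e-suc i k = by-cases (i FP.≟ k)
    where
    by-cases : Dec (i ≡ k) → e (F.suc i) (F.suc k) ≡ e i k
    by-cases (yes i≡k) = trans (e-diag (cong F.suc i≡k)) (sym (e-diag i≡k))
    by-cases (no  i≢k) = trans (e-off-diag (i≢k ∘ FP.suc-injective)) (sym (e-off-diag i≢k))

  ⟨,e⟩ : ∀ {m} (w : Fin m → ℤ) i → ⟨ w , e i ⟩ ≡ w i
  ⟨,e⟩ {suc m} w F.zero = begin
    w F.zero * 1ℤ + ⟨ tail w , zeroV ⟩  ≡⟨ cong₂ _+_ (ℤP.*-identityʳ (w F.zero)) (⟨,⟩-zero (tail w)) ⟩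
    w F.zero + 0ℤ                       ≡⟨ ℤP.+-identityʳ (w F.zero) ⟩
    w F.zero                            ∎
    where open ≡-Reasoning
  ⟨,e⟩ {suc m} w (F.suc i) = begin
    w F.zero * 0ℤ + ⟨ tail w , (λ k → e (F.suc i) (F.suc k)) ⟩  ≡⟨ cong₂ _+_ (ℤP.*-zeroʳ (w F.zero)) (⟨,⟩-cong (tail w) (e-suc i)) ⟩
    0ℤ + ⟨ tail w , e i ⟩                                       ≡⟨ ℤP.+-identityˡ _ ⟩
    ⟨ tail w , e i ⟩                                            ≡⟨ ⟨,e⟩ (tail w) i ⟩
    w (F.suc i)                                                 ∎
    where open ≡-Reasoning

  ⟨,vec⟩ : (w : Fin n → ℤ) (i j : Fin n) → ⟨ w , vec (i , j) ⟩ ≡ w i - w j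
  ⟨,vec⟩ w i j = begin
    ⟨ w , vec (i , j) ⟩                      ≡⟨ ⟨,⟩-cong w (λ k → split (e i k) (e j k)) ⟩
    ⟨ w , e i +V ((- 1ℤ) ·V e j) ⟩             ≡⟨ ⟨,⟩-+ w (e i) ((- 1ℤ) ·V e j) ⟩
    ⟨ w , e i ⟩ + ⟨ w , (- 1ℤ) ·V e j ⟩        ≡⟨ cong (⟨ w , e i ⟩ +_) (⟨,⟩-· w (- 1ℤ) (e j)) ⟩
    ⟨ w , e i ⟩ + - 1ℤ * ⟨ w , e j ⟩         ≡⟨ cong₂ (λ x y → x + - 1ℤ * y) (⟨,e⟩ w i) (⟨,e⟩ w j) ⟩
    w i + - 1ℤ * w j                         ≡⟨ split (w i) (w j) ⟨
    w i - w j                                ∎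
    where
    open ≡-Reasoning
    split : ∀ x y → x - y ≡ x + - 1ℤ * y
    split = solve-∀

  ⟨,lincomb⟩ : (w : Fin n → ℤ) (M : List (Edge n)) → All (λ x → ⟨ w , vec x ⟩ ≡ 0ℤ) M →
               ∀ c → ⟨ w , lincomb M c ⟩ ≡ 0ℤ
  ⟨,lincomb⟩ w []      []       c = ⟨,⟩-zero w
  ⟨,lincomb⟩ w (x ∷ M) (wx ∷ wM) c = begin
    ⟨ w , (c F.zero ·V vec x) +V lincomb M (tail c) ⟩          ≡⟨ ⟨,⟩-+ w _ _ ⟩
    ⟨ w , c F.zero ·V vec x ⟩ + ⟨ w , lincomb M (tail c) ⟩     ≡⟨ cong₂ _+_ (⟨,⟩-· w (c F.zero) (vec x)) (⟨,lincomb⟩ w M wM (tail c)) ⟩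
    c F.zero * ⟨ w , vec x ⟩ + 0ℤ                              ≡⟨ cong (λ y → c F.zero * y + 0ℤ) wx ⟩
    c F.zero * 0ℤ + 0ℤ                                         ≡⟨ cong (_+ 0ℤ) (ℤP.*-zeroʳ (c F.zero)) ⟩
    0ℤ                                                         ∎
    where open ≡-Reasoning

  module _ (L : List (Edge n)) (i : Fin n) where
    indicator : Fin n → ℤ
    indicator k with conn? L i k
    ... | yes _ = 1ℤ
    ... | no  _ = 0ℤ

    indicator-∈ : ∀ {k} → Conn L i k → indicator k ≡ 1ℤ
    indicator-∈ {k} ik with conn? L i k
    ... | yes _   = refl
    ... | no  ¬ik = contradiction ik ¬ik

    indicator-∉ : ∀ {k} → ¬ Conn L i k → indicator k ≡ 0ℤ
    indicator-∉ {k} ¬ik with conn? L i k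
    ... | yes ik = contradiction ik ¬ik
    ... | no  _  = refl

    indicator-edge : ∀ {a b} → (a , b) ∈ L → indicator a ≡ indicator b
    indicator-edge {a} {b} ab∈ = by-cases (conn? L i a) (conn? L i b)
      where
      ab = Conn-edge L ab∈
      by-cases : Dec (Conn L i a) → Dec (Conn L i b) → indicator a ≡ indicator b
      by-cases (yes ia) (yes ib) = trans (indicator-∈ ia) (sym (indicator-∈ ib))
      by-cases (no ¬ia) (no ¬ib) = trans (indicator-∉ ¬ia) (sym (indicator-∉ ¬ib))
      by-cases (yes ia) (no ¬ib) = contradiction (Conn-trans L ia ab) ¬ib
      by-cases (no ¬ia) (yes ib) = contradiction (Conn-trans L ib (Conn-sym L ab)) ¬ia

    ⟨indicator,edges⟩ : ∀ {M} → (∀ {x} → x ∈ M → x ∈ L) → All (λ x → ⟨ indicator , vec x ⟩ ≡ 0ℤ) M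
    ⟨indicator,edges⟩ {[]}          M⊆L = []
    ⟨indicator,edges⟩ {(a , b) ∷ M} M⊆L =
      trans (⟨,vec⟩ indicator a b)
            (trans (cong (_- indicator b) (indicator-edge (M⊆L (here refl)))) (ℤP.+-inverseʳ (indicator b)))
      ∷ ⟨indicator,edges⟩ (M⊆L ∘ there)

    -- Pairing with the indicator of the component of i kills span L but not e_i − e_j.
    InSpan⇒Conn : ∀ {j} → InSpan L (vec (i , j)) → Conn L i j
    InSpan⇒Conn {j} (k , k≢0 , c , c≈) with conn? L i j
    ... | yes ij = ij
    ... | no ¬ij = contradiction k≡0 k≢0
      where
      open ≡-Reasoning
      k≡0 : k ≡ 0ℤ
      k≡0 = begin
        k                                          ≡⟨ ℤP.*-identityʳ k ⟨
        k * (1ℤ - 0ℤ)                              ≡⟨ cong (k *_) (cong₂ _-_ (indicator-∈ (Conn-refl L)) (indicator-∉ ¬ij)) ⟨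
        k * (indicator i - indicator j)            ≡⟨ cong (k *_) (⟨,vec⟩ indicator i j) ⟨
        k * ⟨ indicator , vec (i , j) ⟩            ≡⟨ ⟨,⟩-· indicator k (vec (i , j)) ⟨
        ⟨ indicator , k ·V vec (i , j) ⟩           ≡⟨ ⟨,⟩-cong indicator c≈ ⟨
        ⟨ indicator , lincomb L c ⟩                ≡⟨ ⟨,lincomb⟩ indicator L (⟨indicator,edges⟩ id) c ⟩
        0ℤ                                         ∎

  InSpan-∷ : ∀ x (S : List (Edge n)) {v} → InSpan S v → InSpan (x ∷ S) v
  InSpan-∷ x S (k , k≢0 , c , c≈) = k , k≢0 , (0ℤ ◂ c) , λ t → trans (0*+ (vec x t) (lincomb S c t)) (c≈ t)

  Independent-tail : ∀ x (S : List (Edge n)) → Independent (x ∷ S) → Independent S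
  Independent-tail x S ind c c≈0 t =
    ind (0ℤ ◂ c) (λ k → trans (0*+ (vec x k) (lincomb S c k)) (c≈0 k)) (F.suc t)

  Independent⇒¬Conn : ∀ {i j} (S : List (Edge n)) → Independent ((i , j) ∷ S) → ¬ Conn S i j
  Independent⇒¬Conn {i} {j} S ind ij =
    let c , c≈ = Conn⇒lincomb S ij in
    contradiction (ind (- 1ℤ ◂ c) (λ k → trans (cong (- 1ℤ * vec (i , j) k +_) (c≈ k)) (cancel (vec (i , j) k))) F.zero)
                  (λ ())
    where
    cancel : ∀ x → - 1ℤ * x + x ≡ 0ℤ
    cancel = solve-∀

  -- A dependency with nonzero coefficient on the new edge would put e_i − e_j into span S.
  Independent-∷ : ∀ {i j} (S : List (Edge n)) → Independent S → ¬ Conn S i j → Independent ((i , j) ∷ S)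
  Independent-∷ {i} {j} S ind ¬ij c c≈0 = coefficients-vanish
    where
    head≡0 : c F.zero ≡ 0ℤ
    head≡0 with c F.zero ℤP.≟ 0ℤ
    ... | yes c₀≡0 = c₀≡0
    ... | no  c₀≢0 = contradiction (InSpan⇒Conn S i (c F.zero , c₀≢0 , (λ t → - tail c t) , λ k →
            trans (lincomb-neg S (tail c) k) (move (c F.zero) (vec (i , j) k) (lincomb S (tail c) k) (c≈0 k)))) ¬ij
      where
      move : ∀ a v x → a * v + x ≡ 0ℤ → - x ≡ a * v
      move a v x sum≡0 = trans (sym (ℤP.+-identityʳ (- x))) (trans (cong (- x +_) (sym sum≡0)) (cancel a v x))
        where
        cancel : ∀ a v x → - x + (a * v + x) ≡ a * v
        cancel = solve-∀
    coefficients-vanish : ∀ t → c t ≡ 0ℤ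
    coefficients-vanish F.zero    = head≡0
    coefficients-vanish (F.suc t) = ind (tail c) (λ k → trans (sym (0*+ (vec (i , j) k) (lincomb S (tail c) k)))
      (trans (cong (λ a → a * vec (i , j) k + lincomb S (tail c) k) (sym head≡0)) (c≈0 k))) t

module _ {n : ℕ} where
  open import Data.Nat using (_+_)
  import Data.List.Relation.Unary.All as All
  open import Data.List.Relation.Unary.All using ([]; _∷_)
  open import Data.List.Relation.Binary.Sublist.Propositional using (_⊆_; []; _∷_; _∷ʳ_)
  open import Data.List.Relation.Binary.Sublist.Propositional.Properties using (Any-resp-⊆)

  SpanSub⇒⊆ᶜ : {L M : List (Edge n)} → SpanSub L M → L ⊆ᶜ M
  SpanSub⇒⊆ᶜ {L} {M} sub = Conn-least L M (λ e∈ → InSpan⇒Conn M _ (All.lookup sub e∈))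

  ⊆ᶜ⇒SpanSub : {L M : List (Edge n)} → L ⊆ᶜ M → SpanSub L M
  ⊆ᶜ⇒SpanSub {[]}          L⊆M = []
  ⊆ᶜ⇒SpanSub {(i , j) ∷ L} {M} L⊆M =
    Conn⇒InSpan M (L⊆M (Conn-edge ((i , j) ∷ L) (here refl))) ∷ ⊆ᶜ⇒SpanSub (L⊆M ∘ Conn-∷ (i , j) L)

  Independent⇒components : (S : List (Edge n)) → Independent S → components S + length S ≡ n
  Independent⇒components [] ind = trans (ℕP.+-identityʳ _) components-[]
  Independent⇒components ((i , j) ∷ S) ind = begin
    components ((i , j) ∷ S) + suc (length S)  ≡⟨ ℕP.+-suc (components ((i , j) ∷ S)) (length S) ⟩
    suc (components ((i , j) ∷ S)) + length S  ≡⟨ cong (_+ length S) (components-∷-bridge S (Independent⇒¬Conn S ind)) ⟩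
    components S + length S                    ≡⟨ Independent⇒components S (Independent-tail (i , j) S ind) ⟩
    n                                          ∎
    where open ≡-Reasoning

  SpanningForest : List (Edge n) → Set
  SpanningForest L = Σ (List (Edge n)) λ S → (S ⊆ L) × Independent S × SpanSub L S

  spanningForest : (L : List (Edge n)) → SpanningForest L
  spanningForest [] = [] , [] , (λ _ _ ()) , []
  spanningForest ((i , j) ∷ L) with spanningForest L
  ... | S , S⊆L , ind , L≤S with conn? S i j
  ... | yes ij = S , (i , j) ∷ʳ S⊆L , ind , Conn⇒InSpan S ij ∷ L≤S
  ... | no ¬ij = (i , j) ∷ S , refl ∷ S⊆L , Independent-∷ S ind ¬ij ,
                 Conn⇒InSpan _ (Conn-edge ((i , j) ∷ S) (here refl)) ∷ All.map (InSpan-∷ (i , j) S) L≤S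

  private
    forest-components : ∀ {L S : List (Edge n)} → S ⊆ L → SpanSub L S → components L ≡ components S
    forest-components S⊆L L≤S = components-cong (SpanSub⇒⊆ᶜ L≤S) (Conn-⊆ (Any-resp-⊆ S⊆L))

  HasRank⇒components : (L : List (Edge n)) (r : ℕ) → HasRank L r → components L + r ≡ n
  HasRank⇒components L r (S , S⊆L , |S|≡r , ind , L≤S) =
    trans (cong₂ _+_ (forest-components S⊆L L≤S) (sym |S|≡r)) (Independent⇒components S ind)

  components⇒HasRank : (L : List (Edge n)) (r : ℕ) → components L + r ≡ n → HasRank L r
  components⇒HasRank L r c+r≡n with spanningForest L
  ... | S , S⊆L , ind , L≤S = S , S⊆L , |S|≡r , ind , L≤S
    where
    |S|≡r : length S ≡ r
    |S|≡r = ℕP.+-cancelˡ-≡ (components L) (length S) r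
      (trans (cong (_+ length S) (forest-components S⊆L L≤S)) (trans (Independent⇒components S ind) (sym c+r≡n)))

-- Degrees

module _ {n : ℕ} where
  open import Data.Nat using (_+_)
  open import Data.Bool using (true; false)
  open import Data.List using (filter)
  open import Data.List.Membership.Propositional using (find; lose)
  open import Data.List.Membership.Propositional.Properties using (∈-filter⁺; ∈-filter⁻; ∈-length)
  open import Data.List.Relation.Unary.Any using (any?)
  open import Data.Nat.Tactic.RingSolver using (solve-∀)
  open import Relation.Nullary using (does)
  open import Relation.Nullary.Decidable using (¬?)

  incident? : (a : Fin n) (x : Edge n) → Dec (Incident a x)
  incident? a (i , j) = (a FP.≟ i) ⊎-dec (a FP.≟ j)

  edgesAt awayFrom : Fin n → List (Edge n) → List (Edge n)
  edgesAt  a = filter (incident? a)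
  awayFrom a = filter (¬? ∘ incident? a)

  degree≡length-edgesAt : (a : Fin n) (V : List (Edge n)) → degree V a ≡ length (edgesAt a V)
  degree≡length-edgesAt a [] = refl
  degree≡length-edgesAt a ((i , j) ∷ V) with does ((a FP.≟ i) ⊎-dec (a FP.≟ j))
  ... | true  = cong suc (degree≡length-edgesAt a V)
  ... | false = degree≡length-edgesAt a V

  degree+length-awayFrom : (a : Fin n) (V : List (Edge n)) → degree V a + length (awayFrom a V) ≡ length V
  degree+length-awayFrom a [] = refl
  degree+length-awayFrom a ((i , j) ∷ V) with does ((a FP.≟ i) ⊎-dec (a FP.≟ j))
  ... | true  = cong suc (degree+length-awayFrom a V)
  ... | false = trans (ℕP.+-suc (degree V a) (length (awayFrom a V))) (cong suc (degree+length-awayFrom a V))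

  ∈-awayFrom⁺ : ∀ {a V x} → x ∈ V → ¬ Incident a x → x ∈ awayFrom a V
  ∈-awayFrom⁺ {a} = ∈-filter⁺ (¬? ∘ incident? a)

  ∈-awayFrom⁻ : ∀ {a} V {x} → x ∈ awayFrom a V → x ∈ V × ¬ Incident a x
  ∈-awayFrom⁻ {a} V = ∈-filter⁻ (¬? ∘ incident? a) {xs = V}

  ∈-edgesAt⁺ : ∀ {a V x} → x ∈ V → Incident a x → x ∈ edgesAt a V
  ∈-edgesAt⁺ {a} = ∈-filter⁺ (incident? a)

  ∈-edgesAt⁻ : ∀ {a} V {x} → x ∈ edgesAt a V → x ∈ V
  ∈-edgesAt⁻ {a} V = proj₁ ∘ ∈-filter⁻ (incident? a) {xs = V}

  Conn-isolated : (L : List (Edge n)) {a z : Fin n} → (∀ {x} → x ∈ L → ¬ Incident a x) → Conn L a z → z ≡ a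
  Conn-isolated []            away refl = refl
  Conn-isolated ((i , j) ∷ L) away (inj₁ p) = Conn-isolated L (away ∘ there) p
  Conn-isolated ((i , j) ∷ L) away (inj₂ (inj₁ (p , _))) =
    contradiction (inj₁ (sym (Conn-isolated L (away ∘ there) p))) (away (here refl))
  Conn-isolated ((i , j) ∷ L) away (inj₂ (inj₂ (p , _))) =
    contradiction (inj₂ (sym (Conn-isolated L (away ∘ there) p))) (away (here refl))

  edge-at-non-isolated : (L : List (Edge n)) {a z : Fin n} → Conn L a z → z ≢ a → ∃ λ x → x ∈ L × Incident a x
  edge-at-non-isolated L {a} az z≢a with any? (incident? a) L
  ... | yes at = find at
  ... | no ¬at = contradiction (Conn-isolated L (λ x∈ ax → ¬at (lose x∈ ax)) az) z≢a

  degree-pos : (V : List (Edge n)) {a : Fin n} {x : Edge n} → x ∈ V → Incident a x → 1 ≤ degree V a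
  degree-pos V {a} x∈ ax = subst (1 ≤_) (sym (degree≡length-edgesAt a V)) (∈-length (∈-edgesAt⁺ {V = V} x∈ ax))

  components-++ : (M L : List (Edge n)) → components L ≤ length M + components (M ++ L)
  components-++ []      L = ℕP.≤-refl
  components-++ (x ∷ M) L = begin
    components L                          ≤⟨ components-++ M L ⟩
    length M + components (M ++ L)        ≤⟨ ℕP.+-monoʳ-≤ (length M) (components-∷-≤ x (M ++ L)) ⟩
    length M + suc (components (x ∷ M ++ L)) ≡⟨ ℕP.+-suc (length M) _ ⟩
    length (x ∷ M) + components (x ∷ M ++ L) ∎
    where open ℕP.≤-Reasoning

  -- V without its edges at a still contains L, so it keeps at least n − components L edges.
  degree+n≤length+components : (V L : List (Edge n)) (a : Fin n) →
    (∀ {x} → x ∈ L → x ∈ V) → (∀ {x} → x ∈ L → ¬ Incident a x) →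
    degree V a + n ≤ components L + length V
  degree+n≤length+components V L a L⊆V away = begin
    degree V a + n                                   ≤⟨ ℕP.+-monoʳ-≤ (degree V a) (n≤components+length (awayFrom a V)) ⟩
    degree V a + (components Vₐ + length Vₐ)         ≤⟨ ℕP.+-monoʳ-≤ (degree V a) (ℕP.+-monoˡ-≤ (length Vₐ) L≤Vₐ) ⟩
    degree V a + (components L + length Vₐ)          ≡⟨ swap (degree V a) (components L) (length Vₐ) ⟩
    components L + (degree V a + length Vₐ)          ≡⟨ cong (components L +_) (degree+length-awayFrom a V) ⟩
    components L + length V                          ∎
    where
    open ℕP.≤-Reasoning
    Vₐ = awayFrom a V
    L≤Vₐ : components Vₐ ≤ components L
    L≤Vₐ = components-antitone (Conn-⊆ (λ x∈ → ∈-awayFrom⁺ (L⊆V x∈) (away x∈)))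
    swap : ∀ x y z → x + (y + z) ≡ y + (x + z)
    swap = solve-∀

  module _ (L : List (Edge n)) where
    private module CC = ClassCount (Conn-isDecEquivalence L)

    separated₂ : ∀ {a b} → ¬ Conn L a b → CC.Separated {2} (a ◂ b ◂ λ ())
    separated₂ ¬ab = CC.separated-◂ (λ { (F.zero , r) → ¬ab r ; (F.suc () , _) }) (CC.separated-◂ (λ ()) (λ ()))

    separated₃ : ∀ {a b c} → ¬ Conn L a b → ¬ Conn L a c → ¬ Conn L b c → CC.Separated {3} (a ◂ b ◂ c ◂ λ ())
    separated₃ ¬ab ¬ac ¬bc =
      CC.separated-◂ (λ { (F.zero , r) → ¬ab r ; (F.suc F.zero , r) → ¬ac r ; (F.suc (F.suc ()) , _) })
        (CC.separated-◂ (λ { (F.zero , r) → ¬bc r ; (F.suc () , _) }) (CC.separated-◂ (λ ()) (λ ())))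

    2≤components : ∀ {a b} → ¬ Conn L a b → 2 ≤ components L
    2≤components ¬ab = CC.separated⇒≤classes (separated₂ ¬ab)

    two-components : ∀ {a b} → components L ≡ 2 → ¬ Conn L a b → ∀ z → Conn L z a ⊎ Conn L z b
    two-components eq ¬ab z with CC.separated∧size≡classes⇒covering (separated₂ ¬ab) (sym eq) z
    ... | F.zero , r = inj₁ r
    ... | F.suc F.zero , r = inj₂ r
    ... | F.suc (F.suc ()) , _

    three-components : ∀ {a b c} → components L ≡ 3 → ¬ Conn L a b → ¬ Conn L a c → ¬ Conn L b c →
                       ∀ z → Conn L z a ⊎ Conn L z b ⊎ Conn L z c
    three-components eq ¬ab ¬ac ¬bc z
      with CC.separated∧size≡classes⇒covering (separated₃ ¬ab ¬ac ¬bc) (sym eq) z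
    ... | F.zero , r = inj₁ r
    ... | F.suc F.zero , r = inj₂ (inj₁ r)
    ... | F.suc (F.suc F.zero) , r = inj₂ (inj₂ r)
    ... | F.suc (F.suc (F.suc ())) , _

    unconnected : 2 ≤ components L → ∀ p → ∃ λ y → ¬ Conn L p y
    unconnected 2≤ p with FP.all? (conn? L p)
    ... | no ¬all = FP.¬∀⟶∃¬ n _ (conn? L p) ¬all
    ... | yes all = contradiction (CC.covering⇒classes≤ {h = λ (_ : Fin 1) → p} (λ v → F.zero , Conn-sym L (all v)))
                                  (ℕP.<⇒≱ 2≤)

-- Two colour classes, each joining the two components of the other

module Colours (k : ℕ) (V W : List (Edge (suc (suc (suc (suc k))))))
  (|V| : length V ≡ suc (suc k)) (V-components : components V ≡ 2)
  (V-splits-W : ∀ {i j} → (i , j) ∈ V → ¬ Conn W i j)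
  (W-splits-V : ∀ {i j} → (i , j) ∈ W → ¬ Conn V i j) where

  open import Data.Nat using (_+_)
  open import Data.List.Membership.Propositional.Properties using (∈-++⁻; ∈-++⁺ˡ; ∈-++⁺ʳ)

  private
    n = suc (suc (suc (suc k)))

  ¬Conn-both : ∀ {i j} → (i , j) ∈ V ⊎ (i , j) ∈ W → Conn V i j → ¬ Conn W i j
  ¬Conn-both (inj₁ e∈V) vij wij = V-splits-W e∈V wij
  ¬Conn-both (inj₂ e∈W) vij wij = W-splits-V e∈W vij

  leaf : (L : List (Edge n)) → components L ≤ 3 → (∀ {x} → x ∈ L → x ∈ V) →
         ∀ {a t} → (∀ {x} → x ∈ L → ¬ Incident a x) → Conn V a t → t ≢ a → degree V a ≡ 1
  leaf L L≤3 L⊆V {a} away at t≢a = ℕP.≤-antisym upper lower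
    where
    lower : 1 ≤ degree V a
    lower = let x , x∈ , ax = edge-at-non-isolated V at t≢a in degree-pos V x∈ ax
    upper : degree V a ≤ 1
    upper = ℕP.+-cancelʳ-≤ n (degree V a) 1 (begin
      degree V a + n          ≤⟨ degree+n≤length+components V L a L⊆V away ⟩
      components L + length V ≤⟨ ℕP.+-mono-≤ L≤3 (ℕP.≤-reflexive |V|) ⟩
      1 + n                   ∎)
      where open ℕP.≤-Reasoning

  -- On four vertices one V-edge at t already leaves three components, and it misses r as t and r are W-connected.
  leaf-on-four-vertices : k ≡ 0 → ∀ {r t} → Conn V r t → t ≢ r → Conn W t r → degree V r ≡ 1
  leaf-on-four-vertices k≡0 {r} {t} rt t≢r wtr with edge-at-non-isolated V (Conn-sym V rt) (t≢r ∘ sym)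
  ... | (i , j) , ij∈ , t-at-ij = leaf ((i , j) ∷ []) single≤3 (λ { (here refl) → ij∈ }) away rt t≢r
    where
    ¬Wij = V-splits-W ij∈
    single≤3 : components ((i , j) ∷ []) ≤ 3
    single≤3 = ℕP.≤-reflexive (ℕP.suc-injective (trans (components-∷-bridge [] (¬Conn⇒≢ W ¬Wij))
                                                 (trans components-[] (cong (λ m → suc (suc (suc (suc m)))) k≡0))))
    away : ∀ {x} → x ∈ (i , j) ∷ [] → ¬ Incident r x
    away (here refl) = ¬both-ends t-at-ij
      where
      ¬both-ends : Incident t (i , j) → ¬ Incident r (i , j)
      ¬both-ends (inj₁ refl) (inj₁ refl) = t≢r refl
      ¬both-ends (inj₁ refl) (inj₂ refl) = ¬Wij wtr
      ¬both-ends (inj₂ refl) (inj₁ refl) = ¬Wij (Conn-sym W wtr)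
      ¬both-ends (inj₂ refl) (inj₂ refl) = t≢r refl

  components-awayFrom-leaf : ∀ {a} → degree V a ≡ 1 → components (awayFrom a V) ≡ 3
  components-awayFrom-leaf {a} deg≡1 = ℕP.≤-antisym upper lower
    where
    Vₐ = awayFrom a V
    |Vₐ| : length Vₐ ≡ suc k
    |Vₐ| = ℕP.suc-injective (trans (cong (_+ length Vₐ) (sym deg≡1)) (trans (degree+length-awayFrom a V) |V|))
    split⊆V : ∀ {x} → x ∈ edgesAt a V ++ Vₐ → x ∈ V
    split⊆V x∈ with ∈-++⁻ (edgesAt a V) x∈
    ... | inj₁ x∈at   = ∈-edgesAt⁻ V x∈at
    ... | inj₂ x∈away = proj₁ (∈-awayFrom⁻ V x∈away)
    V⊆split : ∀ {x} → x ∈ V → x ∈ edgesAt a V ++ Vₐ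
    V⊆split {x} x∈ with incident? a x
    ... | yes ax = ∈-++⁺ˡ (∈-edgesAt⁺ x∈ ax)
    ... | no ¬ax = ∈-++⁺ʳ (edgesAt a V) (∈-awayFrom⁺ x∈ ¬ax)
    upper : components Vₐ ≤ 3
    upper = begin
      components Vₐ                                          ≤⟨ components-++ (edgesAt a V) Vₐ ⟩
      length (edgesAt a V) + components (edgesAt a V ++ Vₐ)  ≡⟨ cong₂ _+_ (trans (sym (degree≡length-edgesAt a V)) deg≡1)
                                                                          (trans (components-cong (Conn-⊆ split⊆V) (Conn-⊆ V⊆split)) V-components) ⟩
      3                                                      ∎
      where open ℕP.≤-Reasoning
    lower : 3 ≤ components Vₐ
    lower = ℕP.+-cancelʳ-≤ (suc k) 3 (components Vₐ) (subst (λ m → n ≤ components Vₐ + m) |Vₐ| (n≤components+length Vₐ))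

  module Belt (H L : List (Edge n)) (H-components : components H ≡ 2) (L-components : components L ≡ 3)
              (L⊆G : ∀ {x} → x ∈ L → x ∈ V ⊎ x ∈ W) (L⊆ᶜV : L ⊆ᶜ V) (L⊆ᶜH : L ⊆ᶜ H) where

    L⊆V : ∀ {x} → x ∈ L → x ∈ V
    L⊆V {i , j} x∈ with L⊆G x∈
    ... | inj₁ x∈V = x∈V
    ... | inj₂ x∈W = contradiction (L⊆ᶜV (Conn-edge L x∈)) (W-splits-V x∈W)

    -- An edge of L at s stays in the H-class of s, so it would join two vertices connected in both colours.
    L-avoids : ∀ {s} → (∀ {z} → Conn H s z → Conn W s z) → ∀ {x} → x ∈ L → ¬ Incident s x
    L-avoids sW {i , j} x∈ (inj₁ refl) = ¬Conn-both (L⊆G x∈) (L⊆ᶜV (Conn-edge L x∈)) (sW (L⊆ᶜH (Conn-edge L x∈)))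
    L-avoids sW {i , j} x∈ (inj₂ refl) =
      ¬Conn-both (L⊆G x∈) (L⊆ᶜV (Conn-edge L x∈)) (Conn-sym W (sW (Conn-sym H (L⊆ᶜH (Conn-edge L x∈)))))

    leaf-avoiding-L : ∀ {s t} → (∀ {x} → x ∈ L → ¬ Incident s x) → Conn V s t → t ≢ s → degree V s ≡ 1
    leaf-avoiding-L = leaf L (ℕP.≤-reflexive L-components) L⊆V

    module Split {p q : Fin n} (Hpq : Conn H p q) (¬Vpq : ¬ Conn V p q) {y : Fin n} (¬Hpy : ¬ Conn H p y) where

      ¬Hqy : ¬ Conn H q y
      ¬Hqy qy = ¬Hpy (Conn-trans H Hpq qy)

      L-classes : ∀ z → Conn L z p ⊎ Conn L z q ⊎ Conn L z y
      L-classes = three-components L L-components (¬Vpq ∘ L⊆ᶜV) (¬Hpy ∘ L⊆ᶜH) (¬Hqy ∘ L⊆ᶜH)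

      H-class⊆L-class : ∀ {z} → Conn H y z → Conn L y z
      H-class⊆L-class {z} yz with L-classes z
      ... | inj₁ zp          = contradiction (Conn-sym H (Conn-trans H yz (L⊆ᶜH zp))) ¬Hpy
      ... | inj₂ (inj₁ zq)   = contradiction (Conn-sym H (Conn-trans H yz (L⊆ᶜH zq))) ¬Hqy
      ... | inj₂ (inj₂ zy)   = Conn-sym L zy

      within-H-class : ∀ {s} → Conn H y s → ∀ {z} → Conn H s z → Conn L s z
      within-H-class ys sz = Conn-trans L (Conn-sym L (H-class⊆L-class ys)) (H-class⊆L-class (Conn-trans H ys sz))

      leaf-at-y : (∀ {z} → Conn H y z → Conn W y z) → degree V y ≡ 1
      leaf-at-y yW with two-components V V-components ¬Vpq y
      ... | inj₁ yp = leaf-avoiding-L (L-avoids yW) yp (¬Conn⇒≢ H ¬Hpy)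
      ... | inj₂ yq = leaf-avoiding-L (L-avoids yW) yq (¬Conn⇒≢ H ¬Hqy)

      outside-H-class : (∀ {s} → Conn H p s → ∀ {x} → x ∈ L → ¬ Incident s x) →
                        ∀ z → ¬ Conn H y z → z ≡ p ⊎ z ≡ q
      outside-H-class p-class-away z ¬yz with L-classes z
      ... | inj₁ zp        = inj₁ (Conn-isolated L (p-class-away (Conn-refl H)) (Conn-sym L zp))
      ... | inj₂ (inj₁ zq) = inj₂ (Conn-isolated L (p-class-away Hpq) (Conn-sym L zq))
      ... | inj₂ (inj₂ zy) = contradiction (L⊆ᶜH (Conn-sym L zy)) ¬yz

-- The red and the blue facet of the zonotope

module Zonotope (k : ℕ) (VR VB : List (Edge (suc (suc (suc (suc k))))))
  (|VR| : length VR ≡ suc (suc k)) (VR-rank : HasRank VR (suc (suc k)))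
  (|VB| : length VB ≡ suc (suc k)) (VB-rank : HasRank VB (suc (suc k)))
  (VR-conjugate : ∀ u → u ∈ VR → HasRank (u ∷ VB) (suc (suc (suc k))))
  (VB-conjugate : ∀ u → u ∈ VB → HasRank (u ∷ VR) (suc (suc (suc k)))) where

  open import Data.Nat using (_+_)
  import Data.Sum as Sum
  open import Data.List.Membership.Propositional.Properties using (∈-++⁻; ∈-++⁺ˡ; ∈-++⁺ʳ)
  import Data.List.Relation.Unary.All as All

  private
    n = suc (suc (suc (suc k)))
    d = suc (suc (suc k))

  G = VR ++ VB

  components-of-rank : ∀ {L : List (Edge n)} r c → HasRank L r → c + r ≡ n → components L ≡ c
  components-of-rank {L} r c rank c+r≡n =
    ℕP.+-cancelʳ-≡ r (components L) c (trans (HasRank⇒components L r rank) (sym c+r≡n))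

  edge-of-components : ∀ {L : List (Edge n)} {c} → components L ≡ c → c < n → ∃ λ x → x ∈ L
  edge-of-components {[]}    L≡c c<n = contradiction (subst (_< n) (trans (sym L≡c) components-[]) c<n) (ℕP.n≮n n)
  edge-of-components {x ∷ L} _   _   = x , here refl

  edge-of-components≡3 : ∀ {L : List (Edge n)} → components L ≡ 3 → ∃ λ x → x ∈ L
  edge-of-components≡3 L≡3 = edge-of-components L≡3 (ℕP.m≤m+n 4 k)

  VR-components : components VR ≡ 2
  VR-components = components-of-rank _ 2 VR-rank refl

  VB-components : components VB ≡ 2
  VB-components = components-of-rank _ 2 VB-rank refl

  -- Adding an edge inside a class of W would keep two classes, but the conjugacy makes it one.
  splits : ∀ {V W : List (Edge n)} → components W ≡ 2 → (∀ u → u ∈ V → HasRank (u ∷ W) d) →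
           ∀ {i j} → (i , j) ∈ V → ¬ Conn W i j
  splits {V} {W} W≡2 conjugate {i} {j} e∈ wij with () ←
    trans (sym (components-of-rank d 1 (conjugate (i , j) e∈) refl)) (trans (components-∷-cycle W wij) W≡2)

  colour : ∀ {x} → x ∈ G → x ∈ VR ⊎ x ∈ VB
  colour = ∈-++⁻ VR

  module R = Colours k VR VB |VR| VR-components (splits VB-components VR-conjugate) (splits VR-components VB-conjugate)
  module B = Colours k VB VR |VB| VB-components (splits VR-components VB-conjugate) (splits VB-components VR-conjugate)

  module Backward {a : Fin n} (leafR : degree VR a ≡ 1) (leafB : degree VB a ≡ 1) where
    H VRₐ VBₐ : List (Edge n)
    H   = awayFrom a G
    VRₐ = awayFrom a VR
    VBₐ = awayFrom a VB

    VRₐ⊆VR : ∀ {x} → x ∈ VRₐ → x ∈ VR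
    VRₐ⊆VR = proj₁ ∘ ∈-awayFrom⁻ VR

    VBₐ⊆VB : ∀ {x} → x ∈ VBₐ → x ∈ VB
    VBₐ⊆VB = proj₁ ∘ ∈-awayFrom⁻ VB

    H⊆G : ∀ {x} → x ∈ H → x ∈ G
    H⊆G = proj₁ ∘ ∈-awayFrom⁻ G

    VRₐ⊆H : ∀ {x} → x ∈ VRₐ → x ∈ H
    VRₐ⊆H x∈ = let x∈VR , ¬ax = ∈-awayFrom⁻ VR x∈ in ∈-awayFrom⁺ (∈-++⁺ˡ x∈VR) ¬ax

    VBₐ⊆H : ∀ {x} → x ∈ VBₐ → x ∈ H
    VBₐ⊆H x∈ = let x∈VB , ¬ax = ∈-awayFrom⁻ VB x∈ in ∈-awayFrom⁺ (∈-++⁺ʳ VR x∈VB) ¬ax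

    VRₐ-components : components VRₐ ≡ 3
    VRₐ-components = R.components-awayFrom-leaf leafR

    VBₐ-components : components VBₐ ≡ 3
    VBₐ-components = B.components-awayFrom-leaf leafB

    -- Besides {a}, VRₐ has two classes, and any blue edge away from a joins them.
    H-components : components H ≡ 2
    H-components with edge-of-components≡3 VBₐ-components
    ... | (p , q) , pq∈ = ℕP.≤-antisym upper lower
      where
      ¬Conn-VRₐ : ¬ Conn VRₐ p q
      ¬Conn-VRₐ = splits VR-components VB-conjugate (VBₐ⊆VB pq∈) ∘ Conn-⊆ VRₐ⊆VR
      upper : components H ≤ 2
      upper = begin
        components H                    ≤⟨ components-antitone (Conn-⊆ λ { (here refl) → VBₐ⊆H pq∈ ; (there x∈) → VRₐ⊆H x∈ }) ⟩
        components ((p , q) ∷ VRₐ)      ≡⟨ ℕP.suc-injective (trans (components-∷-bridge VRₐ ¬Conn-VRₐ) VRₐ-components) ⟩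
        2                               ∎
        where open ℕP.≤-Reasoning
      lower : 2 ≤ components H
      lower = 2≤components H λ ap →
        proj₂ (∈-awayFrom⁻ VB pq∈) (inj₁ (sym (Conn-isolated H (proj₂ ∘ ∈-awayFrom⁻ {a = a} G) ap)))

    hasRank : ∀ {L : List (Edge n)} c r → components L ≡ c → c + r ≡ n → HasRank L r
    hasRank {L} c r L≡c c+r≡n = components⇒HasRank L r (trans (cong (_+ r) L≡c) c+r≡n)

    walk : VenkovWalk d G VR VB 2
    walk = step (All.tabulate H⊆G , hasRank 2 _ H-components refl)
                (VRₐ , All.tabulate (∈-++⁺ˡ ∘ VRₐ⊆VR) , hasRank 3 _ VRₐ-components refl ,
                 ⊆ᶜ⇒SpanSub (Conn-⊆ VRₐ⊆VR) , ⊆ᶜ⇒SpanSub (Conn-⊆ VRₐ⊆H))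
         (step (All.tabulate (∈-++⁺ʳ VR) , VB-rank)
               (VBₐ , All.tabulate (∈-++⁺ʳ VR ∘ VBₐ⊆VB) , hasRank 3 _ VBₐ-components refl ,
                ⊆ᶜ⇒SpanSub (Conn-⊆ VBₐ⊆H) , ⊆ᶜ⇒SpanSub (Conn-⊆ VBₐ⊆VB))
         (here (⊆ᶜ⇒SpanSub id , ⊆ᶜ⇒SpanSub id)))

  no-short-walk : ∀ m → m < 2 → ¬ VenkovWalk d G VR VB m
  no-short-walk 0 _ (here (VR≤VB , _)) with edge-of-components VR-components (ℕP.m≤m+n 3 (suc k))
  ... | (i , j) , ij∈ = splits VB-components VR-conjugate ij∈ (SpanSub⇒⊆ᶜ VR≤VB (Conn-edge VR ij∈))
  no-short-walk 1 _ (step _ (L , L⊆G , L-rank , L≤VR , L≤H) (here (H≤VB , _)))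
    with edge-of-components≡3 (components-of-rank _ 3 L-rank refl)
  ... | (i , j) , ij∈ = R.¬Conn-both (colour (All.lookup L⊆G ij∈)) (SpanSub⇒⊆ᶜ L≤VR (Conn-edge L ij∈))
                          (SpanSub⇒⊆ᶜ H≤VB (SpanSub⇒⊆ᶜ L≤H (Conn-edge L ij∈)))
  no-short-walk (suc (suc _)) (s≤s (s≤s ()))

  CommonLeaf : Set
  CommonLeaf = ∃ λ (A : Fin n) → degree VR A ≡ 1 × degree VB A ≡ 1

  module Forward {H Lᴿ Lᴮ : List (Edge n)} (H-components : components H ≡ 2)
                 (Lᴿ-components : components Lᴿ ≡ 3) (Lᴮ-components : components Lᴮ ≡ 3)
                 (Lᴿ⊆G : ∀ {x} → x ∈ Lᴿ → x ∈ G) (Lᴮ⊆G : ∀ {x} → x ∈ Lᴮ → x ∈ G)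
                 (Lᴿ⊆ᶜVR : Lᴿ ⊆ᶜ VR) (Lᴿ⊆ᶜH : Lᴿ ⊆ᶜ H) (Lᴮ⊆ᶜH : Lᴮ ⊆ᶜ H) (Lᴮ⊆ᶜVB : Lᴮ ⊆ᶜ VB) where

    module BR = R.Belt H Lᴿ H-components Lᴿ-components (colour ∘ Lᴿ⊆G) Lᴿ⊆ᶜVR Lᴿ⊆ᶜH
    module BB = B.Belt H Lᴮ H-components Lᴮ-components (Sum.swap ∘ colour ∘ Lᴮ⊆G) Lᴮ⊆ᶜVB Lᴮ⊆ᶜH

    module _ {p q p′ q′ : Fin n} (pq∈ : (p , q) ∈ Lᴮ) (pq′∈ : (p′ , q′) ∈ Lᴿ) where
      Hpq : Conn H p q
      Hpq = Lᴮ⊆ᶜH (Conn-edge Lᴮ pq∈)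

      ¬VRpq : ¬ Conn VR p q
      ¬VRpq vr = R.¬Conn-both (colour (Lᴮ⊆G pq∈)) vr (Lᴮ⊆ᶜVB (Conn-edge Lᴮ pq∈))

      Hp′q′ : Conn H p′ q′
      Hp′q′ = Lᴿ⊆ᶜH (Conn-edge Lᴿ pq′∈)

      ¬VBp′q′ : ¬ Conn VB p′ q′
      ¬VBp′q′ = R.¬Conn-both (colour (Lᴿ⊆G pq′∈)) (Lᴿ⊆ᶜVR (Conn-edge Lᴿ pq′∈))

      common-leaf-if-Conn : Conn H p p′ → CommonLeaf
      common-leaf-if-Conn pp′ with unconnected H (ℕP.≤-reflexive (sym H-components)) p
      ... | y , ¬py = y , SR.leaf-at-y (Lᴮ⊆ᶜVB ∘ SB.H-class⊆L-class) , SB.leaf-at-y (Lᴿ⊆ᶜVR ∘ SR.H-class⊆L-class)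
        where
        module SR = BR.Split Hpq ¬VRpq ¬py
        module SB = BB.Split Hp′q′ ¬VBp′q′ (¬py ∘ Conn-trans H pp′)

      -- The H-classes of p and p′ then are {p , q} and {p′ , q′}: there are only four vertices.
      common-leaf-if-¬Conn : ¬ Conn H p p′ → CommonLeaf
      common-leaf-if-¬Conn ¬pp′ =
        Sum.[ common-leaf-at (Conn-refl H) , common-leaf-at Hpq ]′ (two-components VR VR-components ¬VRpq p′)
        where
        module SR = BR.Split Hpq ¬VRpq ¬pp′
        module SB = BB.Split Hp′q′ ¬VBp′q′ (¬pp′ ∘ Conn-sym H)

        p-class-avoids-Lᴿ : ∀ {s} → Conn H p s → ∀ {x} → x ∈ Lᴿ → ¬ Incident s x
        p-class-avoids-Lᴿ ps = BR.L-avoids (Lᴮ⊆ᶜVB ∘ SB.within-H-class ps)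

        p′-class-avoids-Lᴮ : ∀ {s} → Conn H p′ s → ∀ {x} → x ∈ Lᴮ → ¬ Incident s x
        p′-class-avoids-Lᴮ ps = BB.L-avoids (Lᴿ⊆ᶜVR ∘ SR.within-H-class ps)

        corners : Fin 4 → Fin n
        corners = p ◂ q ◂ p′ ◂ q′ ◂ λ ()

        corner : ∀ z → ∃ λ i → z ≡ corners i
        corner z with conn? H p′ z
        ... | no ¬p′z = Sum.[ (F.zero ,_) , (F.suc F.zero ,_) ]′ (SR.outside-H-class p-class-avoids-Lᴿ z ¬p′z)
        ... | yes p′z = Sum.[ (F.suc (F.suc F.zero) ,_) , (F.suc (F.suc (F.suc F.zero)) ,_) ]′
                          (SB.outside-H-class p′-class-avoids-Lᴮ z (λ pz → ¬pp′ (Conn-trans H pz (Conn-sym H p′z))))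

        k≡0 : k ≡ 0
        k≡0 with FP.injective⇒≤ {f = proj₁ ∘ corner}
                   (λ {z₁} {z₂} i≡ → trans (proj₂ (corner z₁)) (trans (cong corners i≡) (sym (proj₂ (corner z₂)))))
        ... | s≤s (s≤s (s≤s (s≤s z≤n))) = refl

        common-leaf-at : ∀ {r} → Conn H p r → Conn VR p′ r → CommonLeaf
        common-leaf-at {r} pr p′r = r , red , blue
          where
          red : degree VR r ≡ 1
          red = BR.leaf-avoiding-L (p-class-avoids-Lᴿ pr) (Conn-sym VR p′r) λ { refl → ¬pp′ pr }
          blue : degree VB r ≡ 1
          blue with two-components VB VB-components ¬VBp′q′ r
          ... | inj₁ rp′ = B.leaf-on-four-vertices k≡0 rp′ (λ { refl → ¬pp′ pr }) p′r
          ... | inj₂ rq′ = B.leaf-on-four-vertices k≡0 rq′ (λ { refl → ¬pp′ (Conn-trans H pr (Conn-sym H Hp′q′)) })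
                             (Conn-trans VR (Conn-sym VR (Lᴿ⊆ᶜVR (SR.H-class⊆L-class Hp′q′))) p′r)

    common-leaf : CommonLeaf
    common-leaf with edge-of-components≡3 Lᴮ-components | edge-of-components≡3 Lᴿ-components
    ... | (p , q) , pq∈ | (p′ , q′) , pq′∈ with conn? H p p′
    ...   | yes pp′ = common-leaf-if-Conn pq∈ pq′∈ pp′
    ...   | no ¬pp′ = common-leaf-if-¬Conn pq∈ pq′∈ ¬pp′

  forward : VenkovWalk d G VR VB 2 → CommonLeaf
  forward (step (_ , H-rank) (Lᴿ , Lᴿ⊆G , Lᴿ-rank , Lᴿ≤VR , Lᴿ≤H)
            (step _ (Lᴮ , Lᴮ⊆G , Lᴮ-rank , Lᴮ≤H , Lᴮ≤H′) (here (H′≤VB , _)))) =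
    Forward.common-leaf (components-of-rank _ 2 H-rank refl)
      (components-of-rank _ 3 Lᴿ-rank refl) (components-of-rank _ 3 Lᴮ-rank refl)
      (All.lookup Lᴿ⊆G) (All.lookup Lᴮ⊆G) (SpanSub⇒⊆ᶜ Lᴿ≤VR) (SpanSub⇒⊆ᶜ Lᴿ≤H)
      (SpanSub⇒⊆ᶜ Lᴮ≤H) (SpanSub⇒⊆ᶜ H′≤VB ∘ SpanSub⇒⊆ᶜ Lᴮ≤H′)

  backward : CommonLeaf → BeltDistance d G VR VB 2
  backward (_ , leafR , leafB) = Backward.walk leafR leafB , no-short-walk

mainTheorem16 : (d : ℕ) → 3 ≤ d →
    (VR VB : List (Edge (suc d))) →
    All IsVdEdge VR → All IsVdEdge VB → Unique VR → Unique VB →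
    HasRank (VR ++ VB) d →
    Conjugate d VR VB →
    Connected (VR ++ VB) →
    BeltDistance d (VR ++ VB) VR VB 2 ⇔ ∃ (λ (A : Fin (suc d)) → degree VR A ≡ 1 × degree VB A ≡ 1)
mainTheorem16 (suc (suc (suc k))) (s≤s (s≤s (s≤s z≤n))) VR VB _ _ _ _ _
              (|VR| , VR-rank , |VB| , VB-rank , VR-conjugate , VB-conjugate) _ =
  mk⇔ (forward ∘ proj₁) backward
  where open Zonotope k VR VB |VR| VR-rank |VB| VB-rank VR-conjugate VB-conjugate
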